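{- Let $n \geq 1$, let $\Pi \subseteq S_n$ be admissible and shift restricted, and let $m > n$. For vertices $u, v$ of $G_m(\Pi)$ with an arc $u \to v$, and for any letter $y \in B$, we have $p_y(v) \geq p_y(u) - 1$.
   Context: Word graphs: for $\Pi \subseteq S_n$, $m > n$ and a set $B$ with $|B| = m$, the word graph $G_m = G_m(\Pi)$ is the directed graph whose vertices are the words $x_1 \dots x_n$ over $B$ with pairwise distinct letters, with arcs $x_1 x_2 \dots x_n \to x_2 \dots x_n y$ for every $y \in B\setminus\{x_1,\dots,x_n\}$ and $x_1 \dots x_n \to x_{\pi(1)} \dots x_{\pi(n)}$ for every $\pi \in \Pi$. $\Pi$ is admissible if the directed diameter of $G_{4n}(\Pi)$ equals $n$; $\Pi$ is shift restricted if $\pi(i) \leq i+1$ for all $\pi \in \Pi$, $1 \leq i \leq n$. For a vertex $v = x_1 \dots x_n$ and $y \in B$, $p_y(v) = i$ if $y = x_i$, and $p_y(v) = 0$ if $y \notin \{x_1,\dots,x_n\}$. -}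

module Defs where

open import Data.Nat using (ℕ; zero; suc; _*_; _≤_; _<_)
open import Data.Fin using (Fin)
open import Data.Fin.Permutation using (Permutation′; _⟨$⟩ʳ_)
open import Data.Vec using (Vec; []; _∷_; _∷ʳ_; lookup; tabulate)
open import Data.Vec.Membership.Propositional using (_∈_)
open import Data.Vec.Relation.Unary.Unique.Propositional using (Unique)
open import Data.Product using (Σ; ∃; _×_)
open import Relation.Nullary using (¬_; yes; no)
open import Relation.Binary.PropositionalEquality using (_≡_)
import Data.Fin as F

-- Words x₁…xₙ over the alphabet B = Fin m (any m-element set).
-- Vertices of G_m(Π) are the words with pairwise distinct letters (Unique).
Word : ℕ → ℕ → Set
Word m n = Vec (Fin m) n

PermSet : ℕ → Set₁
PermSet n = Permutation′ n → Set

shiftW : ∀ {m n} → Word m n → Fin m → Word m n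
shiftW []       y = []
shiftW (x ∷ xs) y = xs ∷ʳ y

permW : ∀ {m n} → Permutation′ n → Word m n → Word m n
permW π x = tabulate (λ i → lookup x (π ⟨$⟩ʳ i))

data Arc {m n : ℕ} (Π : PermSet n) : Word m n → Word m n → Set where
  shiftArc : ∀ {x} (y : Fin m) → ¬ (y ∈ x) → Arc Π x (shiftW x y)
  permArc  : ∀ {x} (π : Permutation′ n) → Π π → Arc Π x (permW π x)

data Walk {m n : ℕ} (Π : PermSet n) : Word m n → Word m n → ℕ → Set where
  nil  : ∀ {x} → Walk Π x x zero
  cons : ∀ {x y z k} → Arc Π x y → Walk Π y z k → Walk Π x z (suc k)

DistLE : ∀ {m n} → PermSet n → Word m n → Word m n → ℕ → Set
DistLE Π u v d = ∃ λ k → k ≤ d × Walk Π u v k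

DiameterEq : (m : ℕ) {n : ℕ} → PermSet n → ℕ → Set
DiameterEq m {n} Π d =
  ((u v : Word m n) → Unique u → Unique v → DistLE Π u v d)
  × (Σ (Word m n) λ u → Σ (Word m n) λ v → Unique u × Unique v
       × ((k : ℕ) → k < d → ¬ Walk Π u v k))

Admissible : (n : ℕ) → PermSet n → Set
Admissible n Π = DiameterEq (4 * n) Π n

-- π(i) ≤ i+1 (1-based), equivalently toℕ (π i) ≤ suc (toℕ i) (0-based).
ShiftRestricted : (n : ℕ) → PermSet n → Set
ShiftRestricted n Π = (π : Permutation′ n) → Π π → (i : Fin n) → F.toℕ (π ⟨$⟩ʳ i) ≤ suc (F.toℕ i)

-- p_y(v) : i (1-based) if y = x_i (first occurrence), 0 if y does not occur.
pos : ∀ {m n} → Word m n → Fin m → ℕ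
pos [] y = zero
pos (x ∷ xs) y with x F.≟ y
... | yes _ = 1
... | no _ with pos xs y
...   | zero = zero
...   | suc j = suc (suc j)

module Submission where

-- We show that along
-- either kind of arc the position p_y of any letter drops by at most one.
--
--  * Shift arcs: dropping the first letter lowers every position by exactly
--    one, and appending a letter at the end never lowers a position
--    (pos-∷ʳ), so p_y(shift u z) ≥ p_y(u) ∸ 1  (pos-shiftW).
--  * Permutation arcs: if y = u_j, then y = v_{π⁻¹(j)}, so y occurs in v, say
--    first at index i; as u has distinct letters, π(i) = j, and shift
--    restriction gives j ≤ i + 1  (pos-permW).

open import Defs
open import Data.Nat using (ℕ; _≤_; _<_; _∸_; zero; suc; z≤n; s≤s)
open import Data.Nat.Properties using (≤-refl)
open import Data.Fin using (Fin; toℕ)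
import Data.Fin as F
open import Data.Fin.Permutation using (Permutation′; _⟨$⟩ʳ_; _⟨$⟩ˡ_; inverseʳ)
open import Data.Vec using (Vec; []; _∷_; _∷ʳ_; lookup)
open import Data.Vec.Properties using (lookup∘tabulate)
open import Data.Vec.Relation.Unary.Unique.Propositional using (Unique)
open import Data.Vec.Relation.Unary.Unique.Propositional.Properties using (lookup-injective)
open import Data.Product using (Σ; ∃; _,_; _×_)
open import Relation.Nullary using (yes; no; contradiction)
open import Relation.Binary.PropositionalEquality
  using (_≡_; refl; sym; trans; cong; subst₂; module ≡-Reasoning)

pos-∷ʳ : ∀ {m n} (xs : Vec (Fin m) n) (z y : Fin m) → pos xs y ≤ pos (xs ∷ʳ z) y
pos-∷ʳ []       z y = z≤n
pos-∷ʳ (x ∷ xs) z y with x F.≟ y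
... | yes _ = ≤-refl
... | no _ with pos xs y | pos (xs ∷ʳ z) y | pos-∷ʳ xs z y
...   | zero  | _     | _       = z≤n
...   | suc _ | suc _ | s≤s p   = s≤s (s≤s p)

pos-shiftW : ∀ {m n} (u : Vec (Fin m) n) (z y : Fin m) → pos u y ∸ 1 ≤ pos (shiftW u z) y
pos-shiftW []       z y = z≤n
pos-shiftW (x ∷ xs) z y with x F.≟ y
... | yes _ = z≤n
... | no _ with pos xs y | pos-∷ʳ xs z y
...   | zero  | _ = z≤n
...   | suc _ | p = p

pos-occurs : ∀ {m n} (w : Vec (Fin m) n) (y : Fin m) (k : ℕ) → pos w y ≡ suc k
           → Σ (Fin n) λ i → toℕ i ≡ k × lookup w i ≡ y
pos-occurs (x ∷ xs) y k eq with x F.≟ y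
pos-occurs (x ∷ xs) y .0 refl | yes x≡y = F.zero , refl , x≡y
... | no _ with pos xs y | pos-occurs xs y
pos-occurs (x ∷ xs) y .(suc j) refl | no _ | suc j | ih with ih j refl
...   | i , i≡j , wi≡y = F.suc i , cong suc i≡j , wi≡y

occurs-pos : ∀ {m n} (w : Vec (Fin m) n) (y : Fin m) (j : Fin n) → lookup w j ≡ y
           → ∃ λ k → pos w y ≡ suc k
occurs-pos (x ∷ xs) y j eq with x F.≟ y
... | yes _ = 0 , refl
occurs-pos (x ∷ xs) y F.zero    eq | no x≢y = contradiction eq x≢y
occurs-pos (x ∷ xs) y (F.suc j) eq | no _ with pos xs y | occurs-pos xs y j eq
... | suc k | _ = suc k , refl
... | zero  | (_ , ())

pos-permW : ∀ {m n} (π : Permutation′ n) → (∀ i → toℕ (π ⟨$⟩ʳ i) ≤ suc (toℕ i))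
          → (u : Vec (Fin m) n) → Unique u → (y : Fin m) → pos u y ∸ 1 ≤ pos (permW π u) y
pos-permW π restricted u distinct y with pos u y in pos-u
... | zero  = z≤n
... | suc k with pos-occurs u y k pos-u
...   | j , j≡k , uj≡y with occurs-pos (permW π u) y (π ⟨$⟩ˡ j) y-in-v
  where
    y-in-v : lookup (permW π u) (π ⟨$⟩ˡ j) ≡ y
    y-in-v = begin
      lookup (permW π u) (π ⟨$⟩ˡ j) ≡⟨ lookup∘tabulate _ (π ⟨$⟩ˡ j) ⟩
      lookup u (π ⟨$⟩ʳ (π ⟨$⟩ˡ j))   ≡⟨ cong (lookup u) (inverseʳ π) ⟩
      lookup u j                     ≡⟨ uj≡y ⟩
      y                              ∎
      where open ≡-Reasoning
...     | k′ , pos-v with pos-occurs (permW π u) y k′ pos-v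
...       | i , i≡k′ , vi≡y rewrite pos-v =
  subst₂ _≤_ (trans (cong toℕ πi≡j) j≡k) (cong suc i≡k′) (restricted i)
  where
    -- The goal is now k ≤ suc k′, i.e. j ≤ i + 1 by shift restriction, as
    -- u_{π(i)} = v_i = y = u_j, and u has distinct letters.
    πi≡j : π ⟨$⟩ʳ i ≡ j
    πi≡j = lookup-injective distinct _ _
             (trans (sym (lookup∘tabulate _ i)) (trans vi≡y (sym uj≡y)))

mainTheorem15 : (n : ℕ) → 1 ≤ n → (Π : PermSet n) → Admissible n Π → ShiftRestricted n Π
    → (m : ℕ) → n < m → (u v : Word m n) → Unique u → Unique v → Arc Π u v
    → (y : Fin m) → pos u y ∸ 1 ≤ pos v y
mainTheorem15 _ _ _ _ _ _ _ u _ _ _ (shiftArc z _) y = pos-shiftW u z y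
mainTheorem15 _ _ _ _ restricted _ _ u _ distinct _ (permArc π π∈Π) y =
  pos-permW π (restricted π π∈Π) u distinct y
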